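{- Let $k\ge 1$ and $a_1,\dots,a_k\in\mathbb{Z}$. Let $(f_n)_{n\ge 0}$ be defined by $f_0=1$, $f_h=0$ for $h<0$, and $f_n=a_1f_{n-1}+\dots+a_kf_{n-k}$ for $n\ge 1$. Put $s_i=a_1+\dots+a_i$ for $1\le i\le k$. Consider the succession rule (all jumps equal to $1$) with label types $L_1,\dots,L_k$ (where $L_i$ carries the value $s_i$), root $L_1$, and productions $$(s_i)\rightsquigarrow (s_{i+1})(a_1)^{s_i-1}\quad (1\le i\le k-1),\qquad (s_k)\rightsquigarrow (s_k)(a_1)^{s_k-1},$$ i.e. for $1\le i\le k-1$ a node of type $L_i$ has one child of type $L_{i+1}$ and $s_i-1$ (signed) children of type $L_1$, and a node of type $L_k$ has one child of type $L_k$ and $s_k-1$ (signed) children of type $L_1$ (multiplicities of the same type being added). Then the signed level counts $F_n$ of this rule satisfy $F_n=f_n$ for all $n\ge 0$; equivalently, the rule has generating function $\frac{1}{1-a_1x-a_2x^2-\dots-a_kx^k}$.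
   Context: A succession rule (possibly with marked labels) is given by a set of label types, a root type, and for each pair of label types $t,t'$ an integer multiplicity $m(t,t')$. Its generating tree: the root has the root type, weight $+1$, level $0$; a node of type $t$ and weight $\varepsilon\in\{\pm1\}$ at level $n$ has, for each $t'$ with $m(t,t')\ne 0$, exactly $|m(t,t')|$ children of type $t'$ at level $n+1$, each of weight $\varepsilon\cdot\mathrm{sign}(m(t,t'))$. The notation $(t)^m$ with $m<0$ denotes $|m|$ marked copies (weight $-1$). Distinct label types are kept distinct even if their numerical values coincide. The signed level count $F_n$ is the sum of the weights of the nodes at level $n$, and the generating function of the rule is $\sum_{n\ge0}F_nx^n$. -}

module Defs where

open import Data.Nat using (ℕ; zero; suc)
open import Data.Integer using (ℤ; +_; +0; +[1+_]; -[1+_]; _+_; _-_; _*_; ∣_∣; -_; 1ℤ; 0ℤ)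
open import Data.Fin using (Fin; zero; suc; toℕ; inject₁; fromℕ)
open import Data.List using (List; []; _∷_; concatMap; replicate; map; foldr; allFin)
open import Data.Fin using () renaming (_≟_ to _≟F_)
open import Data.Product using (_×_; _,_; proj₂)
open import Relation.Nullary using (yes; no)

record SuccessionRule : Set where
  field
    types : ℕ
    root  : Fin types
    mult  : Fin types → Fin types → ℤ

sgn : ℤ → ℤ
sgn +0       = 0ℤ
sgn +[1+ _ ] = 1ℤ
sgn -[1+ _ ] = - 1ℤ

module _ (R : SuccessionRule) where
  open SuccessionRule R

  -- a node: its type and its weight (±1)
  Node : Set
  Node = Fin types × ℤ

  children : Node → List Node
  children (t , ε) =
    concatMap (λ t' → replicate ∣ mult t t' ∣ (t' , ε * sgn (mult t t')))
              (allFin types)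

  level : ℕ → List Node
  level zero    = (root , 1ℤ) ∷ []
  level (suc n) = concatMap children (level n)

  F : ℕ → ℤ
  F n = foldr _+_ 0ℤ (map proj₂ (level n))

Σ : (k : ℕ) → (Fin k → ℤ) → ℤ
Σ zero    g = 0ℤ
Σ (suc k) g = g zero + Σ k (λ i → g (suc i))

-- The linear recurrence.  Coefficients a_1..a_k are given as
-- a : Fin k → ℤ with a i = a_{toℕ i + 1}.
-- hist a n j = f_{n-j} (with f_h = 0 for h < 0).

hist : {k : ℕ} → (Fin k → ℤ) → ℕ → ℕ → ℤ
hist a zero    zero    = 1ℤ
hist a zero    (suc j) = 0ℤ
hist {k} a (suc n) zero = Σ k (λ i → a i * hist a n (toℕ i))
hist a (suc n) (suc j) = hist a n j

f : {k : ℕ} → (Fin k → ℤ) → ℕ → ℤ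
f a n = hist a n 0

-- The specific rule.  We take k = suc k' (k ≥ 1); label type L_{i+1}
-- is represented by i : Fin (suc k').

s : {k : ℕ} → (Fin k → ℤ) → Fin k → ℤ
s a zero    = a zero
s a (suc i) = a zero + s (λ j → a (suc j)) i

-- successor type: L_i ↦ L_{i+1} for i < k, and L_k ↦ L_k
next : {k : ℕ} → Fin (suc k) → Fin (suc k)
next {zero}  zero    = zero
next {suc k} zero    = suc zero
next {suc k} (suc i) = suc (next i)

[_≡ᶠ_] : {k : ℕ} → Fin k → Fin k → ℤ
[ i ≡ᶠ j ] with i ≟F j
... | yes _ = 1ℤ
... | no  _ = 0ℤ

-- (s_i) ⇝ (s_{next i}) (a_1)^{s_i - 1}, multiplicities of equal types added
ruleOf : {k : ℕ} → (Fin (suc k) → ℤ) → SuccessionRule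
ruleOf {k} a = record
  { types = suc k
  ; root  = zero
  ; mult  = λ t t' → [ t' ≡ᶠ next t ] + [ t' ≡ᶠ zero ] * (s a t - 1ℤ)
  }

module Submission where

-- Let M be the transfer matrix (m(t,t')) of a rule.  The signed number of level-n
-- descendants of a node of type t is (Mⁿ𝟙)(t), so F_n = (Mⁿ𝟙)(root).  For the rule
-- at hand (M g)(L_i) = g(L_{i+1}) + (s_i - 1) g(L_1), and by induction on n
--   (Mⁿ𝟙)(L_{i+1}) = f_n + Σ_{r=1}^{i} Σ_{q≥0} a_{q+r+1} f_{n-1-q},
-- the correction term vanishing at the root L_1.

open import Defs
open import Data.Fin using (Fin; zero; suc; toℕ)
open import Data.Fin using () renaming (_≟_ to _≟F_)
open import Data.Integer using (ℤ; +_; +0; +[1+_]; -[1+_]; _+_; _-_; _*_; ∣_∣; -_; 1ℤ; 0ℤ)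
open import Data.Integer.Properties
  using (+-*-semiring; +-identityˡ; +-identityʳ; +-assoc; *-zeroʳ; *-identityˡ; *-identityʳ)
open import Data.Integer.Tactic.RingSolver using (solve-∀)
open import Data.List using (List; []; _∷_; _++_; concatMap; replicate; map; foldr; tabulate)
open import Data.Nat using (ℕ; zero; suc)
open import Data.Nat.GeneralisedArithmetic using (fold; iterate; iterate-is-fold)
open import Data.Product using (_,_; proj₂)
open import Function using (_∘_; id)
open import Relation.Binary.PropositionalEquality using (_≡_; refl; sym; trans; cong; cong₂; module ≡-Reasoning)
open import Relation.Nullary using (yes; no)
open ≡-Reasoning

open import Algebra.Properties.Semiring.Sum +-*-semiring
  using (sum; sum-cong-≗; ∑-distrib-+; *-distribˡ-sum; sum-replicate-zero)

Σ≡sum : ∀ k (g : Fin k → ℤ) → Σ k g ≡ sum g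
Σ≡sum zero    g = refl
Σ≡sum (suc k) g = cong (_+_ (g zero)) (Σ≡sum k (g ∘ suc))

[≡ᶠ]-suc : ∀ {k} (i j : Fin k) → [ suc i ≡ᶠ suc j ] ≡ [ i ≡ᶠ j ]
[≡ᶠ]-suc i j with i ≟F j
... | yes _ = refl
... | no  _ = refl

sum-[≡ᶠ]* : ∀ {k} (j : Fin k) (g : Fin k → ℤ) → sum (λ t → [ t ≡ᶠ j ] * g t) ≡ g j
sum-[≡ᶠ]* {suc k} zero g = begin
  1ℤ * g zero + sum {k} (λ _ → 0ℤ)  ≡⟨ cong₂ _+_ (*-identityˡ (g zero)) (sum-replicate-zero k) ⟩
  g zero + 0ℤ                        ≡⟨ +-identityʳ (g zero) ⟩
  g zero                             ∎
sum-[≡ᶠ]* {suc k} (suc j) g = begin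
  0ℤ + sum (λ t → [ suc t ≡ᶠ suc j ] * g (suc t))
    ≡⟨ cong (_+_ 0ℤ) (sum-cong-≗ (λ t → cong (_* g (suc t)) ([≡ᶠ]-suc t j))) ⟩
  0ℤ + sum (λ t → [ t ≡ᶠ j ] * g (suc t))
    ≡⟨ cong (_+_ 0ℤ) (sum-[≡ᶠ]* j (g ∘ suc)) ⟩
  0ℤ + g (suc j)
    ≡⟨ +-identityˡ (g (suc j)) ⟩
  g (suc j) ∎

+∣i∣*sgn-i≡i : ∀ i → + ∣ i ∣ * sgn i ≡ i
+∣i∣*sgn-i≡i +0       = refl
+∣i∣*sgn-i≡i +[1+ n ] = *-identityʳ +[1+ n ]
+∣i∣*sgn-i≡i -[1+ n ] = x*-1≡-x +[1+ n ]
  where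
  x*-1≡-x : ∀ x → x * - 1ℤ ≡ - x
  x*-1≡-x = solve-∀

module _ (R : SuccessionRule) where
  open SuccessionRule R

  transfer : (Fin types → ℤ) → Fin types → ℤ
  transfer g t = sum (λ t' → mult t t' * g t')

  count : (Fin types → ℤ) → List (Node R) → ℤ
  count g []            = 0ℤ
  count g ((t , ε) ∷ L) = ε * g t + count g L

  count-++ : ∀ g xs ys → count g (xs ++ ys) ≡ count g xs + count g ys
  count-++ g []             ys = sym (+-identityˡ (count g ys))
  count-++ g ((t , ε) ∷ xs) ys = trans (cong (_+_ (ε * g t)) (count-++ g xs ys))
                                       (sym (+-assoc (ε * g t) (count g xs) (count g ys)))

  count-replicate : ∀ g c t ε → count g (replicate c (t , ε)) ≡ + c * (ε * g t)
  count-replicate g zero    t ε = refl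
  count-replicate g (suc c) t ε = trans (cong (_+_ (ε * g t)) (count-replicate g c t ε))
                                        (x+c*x≡[1+c]*x (ε * g t) (+ c))
    where
    x+c*x≡[1+c]*x : ∀ x c → x + c * x ≡ (1ℤ + c) * x
    x+c*x≡[1+c]*x = solve-∀

  count-concatMap-tabulate : ∀ g {n} (h : Fin types → List (Node R)) (e : Fin n → Fin types) →
                             count g (concatMap h (tabulate e)) ≡ sum (λ i → count g (h (e i)))
  count-concatMap-tabulate g {zero}  h e = refl
  count-concatMap-tabulate g {suc n} h e =
    trans (count-++ g (h (e zero)) _)
          (cong (_+_ (count g (h (e zero)))) (count-concatMap-tabulate g h (e ∘ suc)))

  count-children : ∀ g t ε → count g (children R (t , ε)) ≡ ε * transfer g t
  count-children g t ε = begin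
    count g (children R (t , ε))
      ≡⟨ count-concatMap-tabulate g _ id ⟩
    sum (λ t' → count g (replicate ∣ mult t t' ∣ (t' , ε * sgn (mult t t'))))
      ≡⟨ sum-cong-≗ (λ t' → trans (count-replicate g ∣ mult t t' ∣ t' (ε * sgn (mult t t')))
                                  (unsign (mult t t') (g t'))) ⟩
    sum (λ t' → ε * (mult t t' * g t'))
      ≡⟨ sym (*-distribˡ-sum ε (λ t' → mult t t' * g t')) ⟩
    ε * transfer g t ∎
    where
    regroup : ∀ c e σ x → c * ((e * σ) * x) ≡ e * ((c * σ) * x)
    regroup = solve-∀
    unsign : ∀ m x → + ∣ m ∣ * ((ε * sgn m) * x) ≡ ε * (m * x)
    unsign m x = trans (regroup (+ ∣ m ∣) ε (sgn m) x) (cong (λ z → ε * (z * x)) (+∣i∣*sgn-i≡i m))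

  count-concatMap-children : ∀ g L → count g (concatMap (children R) L) ≡ count (transfer g) L
  count-concatMap-children g []            = refl
  count-concatMap-children g ((t , ε) ∷ L) =
    trans (count-++ g (children R (t , ε)) _)
          (cong₂ _+_ (count-children g t ε) (count-concatMap-children g L))

  count-level : ∀ n g → count g (level R n) ≡ iterate transfer g n root
  count-level zero    g = trans (+-identityʳ (1ℤ * g root)) (*-identityˡ (g root))
  count-level (suc n) g = trans (count-concatMap-children g (level R n)) (count-level n (transfer g))

  sum-weights≡count-𝟙 : ∀ L → foldr _+_ 0ℤ (map proj₂ L) ≡ count (λ _ → 1ℤ) L
  sum-weights≡count-𝟙 []            = refl
  sum-weights≡count-𝟙 ((t , ε) ∷ L) = cong₂ _+_ (sym (*-identityʳ ε)) (sum-weights≡count-𝟙 L)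

  F≡transferⁿ-𝟙 : ∀ n → F R n ≡ fold (λ _ → 1ℤ) transfer n root
  F≡transferⁿ-𝟙 n = begin
    F R n                                    ≡⟨ sum-weights≡count-𝟙 (level R n) ⟩
    count (λ _ → 1ℤ) (level R n)             ≡⟨ count-level n (λ _ → 1ℤ) ⟩
    iterate transfer (λ _ → 1ℤ) n root       ≡⟨ cong (λ h → h root) (sym (iterate-is-fold _ transfer n)) ⟩
    fold (λ _ → 1ℤ) transfer n root          ∎

transfer-ruleOf : ∀ {k} (a : Fin (suc k) → ℤ) g t →
                  transfer (ruleOf a) g t ≡ g (next t) + (s a t - 1ℤ) * g zero
transfer-ruleOf a g t = begin
  sum (λ t' → ([ t' ≡ᶠ next t ] + [ t' ≡ᶠ zero ] * c) * g t')
    ≡⟨ sum-cong-≗ (λ t' → distrib [ t' ≡ᶠ next t ] [ t' ≡ᶠ zero ] c (g t')) ⟩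
  sum (λ t' → [ t' ≡ᶠ next t ] * g t' + [ t' ≡ᶠ zero ] * (c * g t'))
    ≡⟨ ∑-distrib-+ (λ t' → [ t' ≡ᶠ next t ] * g t') (λ t' → [ t' ≡ᶠ zero ] * (c * g t')) ⟩
  sum (λ t' → [ t' ≡ᶠ next t ] * g t') + sum (λ t' → [ t' ≡ᶠ zero ] * (c * g t'))
    ≡⟨ cong₂ _+_ (sum-[≡ᶠ]* (next t) g) (sum-[≡ᶠ]* zero (λ t' → c * g t')) ⟩
  g (next t) + c * g zero ∎
  where
  c : ℤ
  c = s a t - 1ℤ
  distrib : ∀ x y w z → (x + y * w) * z ≡ x * z + y * (w * z)
  distrib = solve-∀

dot : ∀ {m} → (Fin m → ℤ) → (ℕ → ℤ) → ℤ
dot b φ = sum (λ p → b p * φ (toℕ p))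

f-suc : ∀ {k} (a : Fin k → ℤ) n → f a (suc n) ≡ dot a (hist a n)
f-suc {k} a n = Σ≡sum k (λ i → a i * hist a n (toℕ i))

dot-zeroʳ : ∀ {m} (b : Fin m → ℤ) → dot b (λ _ → 0ℤ) ≡ 0ℤ
dot-zeroʳ {m} b = trans (sum-cong-≗ (λ p → *-zeroʳ (b p))) (sum-replicate-zero m)

-- tailSums b ψ i = Σ_{r=1}^{i} Σ_q b_{q+r} ψ(q)
tailSums : ∀ {m} → (Fin (suc m) → ℤ) → (ℕ → ℤ) → Fin (suc m) → ℤ
tailSums         b ψ zero    = 0ℤ
tailSums {suc m} b ψ (suc i) = dot (b ∘ suc) ψ + tailSums (b ∘ suc) ψ i

tailSums-zeroʳ : ∀ {m} (b : Fin (suc m) → ℤ) i → tailSums b (λ _ → 0ℤ) i ≡ 0ℤ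
tailSums-zeroʳ         b zero    = refl
tailSums-zeroʳ {suc m} b (suc i) = cong₂ _+_ (dot-zeroʳ (b ∘ suc)) (tailSums-zeroʳ (b ∘ suc) i)

dot+tailSums : ∀ {m} (b : Fin (suc m) → ℤ) (φ : ℕ → ℤ) i →
               dot b φ + tailSums b φ i ≡ s b i * φ 0 + tailSums b (φ ∘ suc) (next i)
dot+tailSums {zero}  b φ zero    = +-identityʳ (b zero * φ 0 + 0ℤ)
dot+tailSums {suc m} b φ zero    = +-assoc (b zero * φ 0) (dot (b ∘ suc) (φ ∘ suc)) 0ℤ
dot+tailSums {suc m} b φ (suc i) = begin
  (b zero * φ 0 + dot b′ (φ ∘ suc)) + (dot b′ φ + tailSums b′ φ i)
    ≡⟨ cong (_+_ (b zero * φ 0 + dot b′ (φ ∘ suc))) (dot+tailSums b′ φ i) ⟩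
  (b zero * φ 0 + dot b′ (φ ∘ suc)) + (s b′ i * φ 0 + tailSums b′ (φ ∘ suc) (next i))
    ≡⟨ regroup (b zero) (φ 0) (dot b′ (φ ∘ suc)) (s b′ i) (tailSums b′ (φ ∘ suc) (next i)) ⟩
  (b zero + s b′ i) * φ 0 + (dot b′ (φ ∘ suc) + tailSums b′ (φ ∘ suc) (next i)) ∎
  where
  b′ : Fin (suc m) → ℤ
  b′ = b ∘ suc
  regroup : ∀ b₀ p d S c → (b₀ * p + d) + (S * p + c) ≡ (b₀ + S) * p + (d + c)
  regroup = solve-∀

transferⁿ-𝟙-ruleOf : ∀ {k} (a : Fin (suc k) → ℤ) n i →
  fold (λ _ → 1ℤ) (transfer (ruleOf a)) n i ≡ f a n + tailSums a (λ j → hist a n (suc j)) i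
transferⁿ-𝟙-ruleOf a zero    i = sym (cong (_+_ 1ℤ) (tailSums-zeroʳ a i))
transferⁿ-𝟙-ruleOf {k} a (suc n) i = begin
  transfer (ruleOf a) h i
    ≡⟨ transfer-ruleOf a h i ⟩
  h (next i) + (s a i - 1ℤ) * h zero
    ≡⟨ cong₂ (λ x y → x + (s a i - 1ℤ) * y) (transferⁿ-𝟙-ruleOf a n (next i)) (transferⁿ-𝟙-ruleOf a n zero) ⟩
  (f a n + tailSums a φ (next i)) + (s a i - 1ℤ) * (f a n + 0ℤ)
    ≡⟨ collect (f a n) (tailSums a φ (next i)) (s a i) ⟩
  s a i * f a n + tailSums a φ (next i)
    ≡⟨ sym (dot+tailSums a (hist a n) i) ⟩
  dot a (hist a n) + tailSums a (hist a n) i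
    ≡⟨ cong (_+ tailSums a (hist a n) i) (sym (f-suc a n)) ⟩
  f a (suc n) + tailSums a (hist a n) i ∎
  where
  h : Fin (suc k) → ℤ
  h = fold (λ _ → 1ℤ) (transfer (ruleOf a)) n
  φ : ℕ → ℤ
  φ j = hist a n (suc j)
  collect : ∀ x c S → (x + c) + (S - 1ℤ) * (x + 0ℤ) ≡ S * x + c
  collect = solve-∀

proposition2 : (k : ℕ) (a : Fin (suc k) → ℤ) (n : ℕ) →
    F (ruleOf a) n ≡ f a n
proposition2 k a n = begin
  F (ruleOf a) n                                ≡⟨ F≡transferⁿ-𝟙 (ruleOf a) n ⟩
  fold (λ _ → 1ℤ) (transfer (ruleOf a)) n zero  ≡⟨ transferⁿ-𝟙-ruleOf a n zero ⟩
  f a n + 0ℤ                                    ≡⟨ +-identityʳ (f a n) ⟩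
  f a n                                         ∎
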